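{- Let $D$ be a discriminant form of type $2_{I\!I}^{\epsilon n}$ with $n$ even, and let $\gamma\in I$. Then \[\operatorname{inv}_D(e^{\gamma})=\epsilon\,\frac13\,\frac{1}{2^{(n-2)/2}}\Bigg\{\sum_{\mu\in\gamma^{\perp}\cap I}2\,e^{\mu}-\sum_{\mu\in I}e^{\mu}\Bigg\}+\frac13\,e^{\gamma}.\]
   Context: A discriminant form is a finite abelian group $D$ with a quadratic form $\operatorname{q}:D\to\mathbb Q/\mathbb Z$ whose associated bilinear form $(\beta,\gamma)=\operatorname{q}(\beta+\gamma)-\operatorname{q}(\beta)-\operatorname{q}(\gamma)$ is nondegenerate. $2_{I\!I}^{\epsilon n}$ ($n$ even) is the orthogonal sum of $n/2$ forms, each generated by $\gamma,\delta$ of order $2$ with $(\gamma,\delta)=1/2$ and $\operatorname{q}(\gamma)=\operatorname{q}(\delta)=0$ (sign $+$) or $\operatorname{q}(\gamma)=\operatorname{q}(\delta)=1/2$ (sign $-$), $\epsilon$ being the product of the signs; it has level $2$ and even signature $\operatorname{sign}(D)\in\mathbb Z/8\mathbb Z$. $e(x)=e^{2\pi ix}$, $\Gamma=\operatorname{SL}_2(\mathbb Z)$. Weil representation: $\rho_D(T)e^\gamma=e(-\operatorname{q}(\gamma))e^\gamma$, $\rho_D(S)e^\gamma=\frac{e(\operatorname{sign}(D)/8)}{\sqrt{|D|}}\sum_\beta e((\gamma,\beta))e^\beta$; $\operatorname{inv}_D(e^\gamma)=\frac{1}{|\Gamma/\Gamma(2)|}\sum_{M\in\Gamma/\Gamma(2)}\rho_D(M)e^\gamma$.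 $I$ is the set of isotropic elements, $\gamma^\perp=\{\mu:(\mu,\gamma)=0\}$. -}

module Defs where

open import Data.Bool using (Bool; true; false; _xor_; _∧_; _∨_; not; if_then_else_)
open import Data.Product using (_×_; _,_)
open import Data.Nat using (ℕ; zero; suc)
open import Data.Integer using (+_)
open import Data.Rational using (ℚ; _+_; _*_; -_; _/_; 0ℚ; 1ℚ; ½)
open import Data.List using (List; []; _∷_; map; concatMap; foldr)
open import Data.Vec using (Vec; []; _∷_; toList; lookup)
open import Data.Fin using (Fin)
import Data.List

-- Values in (1/2)ℤ/ℤ ⊂ ℚ/ℤ are encoded as Bool: false = 0, true = 1/2.
-- All values of q and of (·,·) on a level-2 discriminant form lie there.
Half : Set
Half = Bool

eH : Half → ℚ
eH false = 1ℚ
eH true  = - 1ℚ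

-- The discriminant form 2_II^{ε n}, n = 2k.  The data is a vector of
-- k signs (true = "+" plane, false = "-" plane).  The underlying group
-- is (ℤ/2)^{2k}: an element is a vector of k pairs (coefficients of γ_i, δ_i).
Elt : ℕ → Set
Elt k = Vec (Bool × Bool) k

-- quadratic form on one plane: x γ + y δ
--  "+" : q = xy/2 ;  "-" : q = (x² + xy + y²)/2
qPlane : Bool → Bool × Bool → Half
qPlane true  (x , y) = x ∧ y
qPlane false (x , y) = (x xor y) xor (x ∧ y)

q : ∀ {k} → Vec Bool k → Elt k → Half
q [] [] = false
q (s ∷ ss) (a ∷ as) = qPlane s a xor q ss as

-- bilinear form: (γ_i,δ_i) = 1/2, (γ_i,γ_i) = (δ_i,δ_i) = 0 (both signs)
bPlane : Bool × Bool → Bool × Bool → Half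
bPlane (x , y) (x' , y') = (x ∧ y') xor (y ∧ x')

bil : ∀ {k} → Elt k → Elt k → Half
bil [] [] = false
bil (a ∷ as) (b ∷ bs) = bPlane a b xor bil as bs

ε : ∀ {k} → Vec Bool k → ℚ
ε [] = 1ℚ
ε (true ∷ ss) = ε ss
ε (false ∷ ss) = - (ε ss)

-- signature sign(D) ∈ ℤ/8 : each "+" plane contributes 0, each "-" plane 4.
-- e(sign(D)/8) is then e(#minus/2); we encode sign(D)/8 mod 1 ∈ (1/2)ℤ/ℤ.
signOver8 : ∀ {k} → Vec Bool k → Half
signOver8 [] = false
signOver8 (true ∷ ss) = signOver8 ss
signOver8 (false ∷ ss) = not (signOver8 ss)

-- 1/sqrt|D| = 1/sqrt(2^{2k}) = (1/2)^k
invSqrtCard : ℕ → ℚ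
invSqrtCard zero = 1ℚ
invSqrtCard (suc k) = ½ * invSqrtCard k

allElt : (k : ℕ) → List (Elt k)
allElt zero = [] ∷ []
allElt (suc k) =
  concatMap (λ a → map (a ∷_) (allElt k))
    ((false , false) ∷ (false , true) ∷ (true , false) ∷ (true , true) ∷ [])

sumQ : List ℚ → ℚ
sumQ = foldr _+_ 0ℚ

ΣD : ∀ k → (Elt k → ℚ) → ℚ
ΣD k f = sumQ (map f (allElt k))

eqB : Bool → Bool → Bool
eqB true true = true
eqB false false = true
eqB _ _ = false

eqElt : ∀ {k} → Elt k → Elt k → Bool
eqElt [] [] = true
eqElt ((x , y) ∷ as) ((x' , y') ∷ bs) = eqB x x' ∧ (eqB y y' ∧ eqElt as bs)

-- The group ring ℂ[D]; all coefficients occurring here are rational, so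
-- a vector Σ_β c_β e^β is represented by its coefficient function β ↦ c_β.
CD : ℕ → Set
CD k = Elt k → ℚ

eVec : ∀ {k} → Elt k → CD k
eVec γ β = if eqElt γ β then 1ℚ else 0ℚ

isIsotropic : ∀ {k} → Vec Bool k → Elt k → Bool
isIsotropic ss μ = not (q ss μ)

data Gen : Set where
  S T : Gen

-- ρ(T) e^γ = e(-q(γ)) e^γ
-- ρ(S) e^γ = e(sign/8)/sqrt|D| Σ_β e((γ,β)) e^β
ρGen : ∀ {k} → Vec Bool k → Gen → CD k → CD k
ρGen {k} ss T v β = eH (q ss β) * v β   -- e(-x) = e(x) for x ∈ (1/2)ℤ/ℤ
ρGen {k} ss S v β =
  (eH (signOver8 ss) * invSqrtCard k) * ΣD k (λ γ → v γ * eH (bil γ β))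

-- a word g₁ g₂ … g_m in S, T denotes the matrix M = g₁ g₂ ⋯ g_m ∈ SL₂(ℤ);
-- ρ(M) = ρ(g₁) ∘ ρ(g₂) ∘ ⋯ ∘ ρ(g_m)
Word : Set
Word = List Gen

ρWord : ∀ {k} → Vec Bool k → Word → CD k → CD k
ρWord ss [] v = v
ρWord ss (g ∷ w) v = ρGen ss g (ρWord ss w v)

-- Reduction mod 2: SL₂(ℤ) → SL₂(ℤ/2) ≅ Γ/Γ(2).  A 2×2 matrix over 𝔽₂
-- is stored as (a , b , c , d) for [[a , b] , [c , d]].
Mat2 : Set
Mat2 = Bool × Bool × Bool × Bool

mul2 : Mat2 → Mat2 → Mat2
mul2 (a , b , c , d) (a' , b' , c' , d') =
  ((a ∧ a') xor (b ∧ c') , (a ∧ b') xor (b ∧ d') ,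
   (c ∧ a') xor (d ∧ c') , (c ∧ b') xor (d ∧ d'))

id2 : Mat2
id2 = (true , false , false , true)

genMod2 : Gen → Mat2
genMod2 S = (false , true , true , false)   -- [[0,-1],[1,0]] mod 2
genMod2 T = (true , true , false , true)

wordMod2 : Word → Mat2
wordMod2 [] = id2
wordMod2 (g ∷ w) = mul2 (genMod2 g) (wordMod2 w)

-- inv_D(v) = (1/|Γ/Γ(2)|) Σ_{M ∈ Γ/Γ(2)} ρ_D(M) v, where the 6 cosets are
-- given by a list of representatives (words in S, T).
invD : ∀ {k} → Vec Bool k → Vec Word 6 → CD k → CD k
invD ss reps v β =
  ((+ 1) / 6) * sumQ (Data.List.map (λ w → ρWord ss w v β) (toList reps))

-- the coefficient vector of the right-hand side of Theorem 4.2: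
-- ε (1/3) (1/2^{(n-2)/2}) { Σ_{μ ∈ γ^⊥ ∩ I} 2 e^μ − Σ_{μ ∈ I} e^μ } + (1/3) e^γ,
-- with n = 2k, so 1/2^{(n-2)/2} = 2 · (1/2)^k.
rhs : ∀ {k} → Vec Bool k → Elt k → CD k
rhs {k} ss γ μ =
  ((ε ss * ((+ 1) / 3)) * ((+ 2) / 1 * invSqrtCard k)) *
    ((if isIsotropic ss μ ∧ not (bil μ γ) then (+ 2) / 1 else 0ℚ)
      + (- (if isIsotropic ss μ then 1ℚ else 0ℚ)))
  + ((+ 1) / 3) * eVec γ μ

{-# OPTIONS --safe #-}
-- For isotropic γ the Γ-orbit of e^γ under ρ_D has only three vectors: e^γ, ρ(S) e^γ = c Σ_μ e((γ,μ)) e^μ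
-- and ρ(T S) e^γ = c Σ_μ e(q(μ) + (γ,μ)) e^μ, with c = e(sign(D)/8) / √|D|.  ρ(M) e^γ depends only on the
-- first column of M mod 2, and each of the three nonzero columns occurs for exactly two of the six
-- elements of SL₂(𝔽₂).  That ρ(S) permutes these vectors is character orthogonality together with the
-- Gauss sum Σ_β e(q(β) + (x,β)) = √|D| e(sign(D)/8) e(q(x)), both of which factor over the hyperbolic planes.
-- Averaging, inv_D(e^γ) = (e^γ + c Σ_μ e((γ,μ)) (1 + e(q(μ))) e^μ) / 3, and 1 + e(q(μ)) = 2 [μ ∈ I].
module Submission where

open import Defs
open import Data.Nat using (ℕ; zero; suc)
open import Data.Bool using (Bool; true; false; _xor_; _∧_; not; if_then_else_)
import Data.Bool.Properties as Boolₚ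
open import Data.Vec using (Vec; []; _∷_; lookup; toList)
open import Data.List using (List; []; _∷_; map; _++_; concatMap)
open import Data.List.Properties using (map-++; map-∘)
open import Data.Product using (_×_; _,_; ∃; proj₁; proj₂)
open import Data.Fin using (Fin; punchOut)
open import Data.Fin.Patterns using (0F; 1F; 2F; 3F; 4F; 5F)
open import Data.Fin.Properties using (any?; punchOut-injective; injective⇒≤)
import Data.Fin.Properties as Finₚ
open import Data.Fin.Permutation using (permutation)
import Data.Integer as ℤ
open import Data.Rational using (ℚ; _+_; _*_; -_; _/_; 0ℚ; 1ℚ; ½)
open import Data.Rational.Properties
  using (_≟_; +-identityˡ; +-identityʳ; *-identityˡ; *-zeroˡ; *-zeroʳ; +-assoc; *-assoc; *-distribˡ-+;
         +-*-commutativeRing; +-0-commutativeMonoid)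
open import Data.Nat.Properties using (<-irrefl)
open import Algebra.Properties.CommutativeMonoid.Sum +-0-commutativeMonoid using (sum; sum-permute; sum-cong-≗)
open import Function.Definitions using (Injective)
open import Level using (0ℓ)
open import Relation.Nullary using (yes; no; contradiction)
open import Relation.Nullary.Decidable using (dec⇒maybe)
open import Relation.Binary.PropositionalEquality using (_≡_; _≢_; refl; sym; trans; cong; cong₂; module ≡-Reasoning)
open import Tactic.RingSolver using (solve-∀)
open import Tactic.RingSolver.Core.AlmostCommutativeRing using (AlmostCommutativeRing; fromCommutativeRing)

ℚ-ring : AlmostCommutativeRing 0ℓ 0ℓ
ℚ-ring = fromCommutativeRing +-*-commutativeRing (λ x → dec⇒maybe (0ℚ ≟ x))

-- Reindexing finite sums

injective⇒surjective : ∀ {n} (f : Fin n → Fin n) → Injective _≡_ _≡_ f → ∀ j → ∃ λ i → f i ≡ j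
injective⇒surjective {suc n} f f-inj j with any? (λ i → f i Finₚ.≟ j)
... | yes hit = hit
... | no miss = contradiction (injective⇒≤ g-inj) (<-irrefl refl)
  where
  j≢f : ∀ i → j ≢ f i
  j≢f i eq = miss (i , sym eq)
  g : Fin (suc n) → Fin n
  g i = punchOut (j≢f i)
  g-inj : Injective _≡_ _≡_ g
  g-inj eq = f-inj (punchOut-injective (j≢f _) (j≢f _) eq)

sum-reindex : ∀ {n} (G : Fin n → ℚ) (f : Fin n → Fin n) → Injective _≡_ _≡_ f →
              sum (λ i → G (f i)) ≡ sum G
sum-reindex G f f-inj = sym (sum-permute G (permutation f f⁻¹ f∘f⁻¹ f⁻¹∘f))
  where
  f⁻¹ = λ j → proj₁ (injective⇒surjective f f-inj j)
  f∘f⁻¹ = λ j → proj₂ (injective⇒surjective f f-inj j)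
  f⁻¹∘f = λ i → f-inj (f∘f⁻¹ (f i))

sumQ-toList : ∀ {A : Set} {n} (f : A → ℚ) (xs : Vec A n) →
              sumQ (map f (toList xs)) ≡ sum (λ i → f (lookup xs i))
sumQ-toList f []       = refl
sumQ-toList f (x ∷ xs) = cong (f x +_) (sumQ-toList f xs)

sumQ-++ : (xs ys : List ℚ) → sumQ (xs ++ ys) ≡ sumQ xs + sumQ ys
sumQ-++ []       ys = sym (+-identityˡ _)
sumQ-++ (x ∷ xs) ys = trans (cong (x +_) (sumQ-++ xs ys)) (sym (+-assoc x _ _))

sumQ-concatMap : ∀ {A B : Set} (f : A → ℚ) (g : B → List A) (xs : List B) →
                 sumQ (map f (concatMap g xs)) ≡ sumQ (map (λ b → sumQ (map f (g b))) xs)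
sumQ-concatMap f g []       = refl
sumQ-concatMap f g (x ∷ xs) = begin
  sumQ (map f (g x ++ concatMap g xs))              ≡⟨ cong sumQ (map-++ f (g x) _) ⟩
  sumQ (map f (g x) ++ map f (concatMap g xs))      ≡⟨ sumQ-++ (map f (g x)) _ ⟩
  sumQ (map f (g x)) + sumQ (map f (concatMap g xs)) ≡⟨ cong (sumQ (map f (g x)) +_) (sumQ-concatMap f g xs) ⟩
  sumQ (map (λ b → sumQ (map f (g b))) (x ∷ xs))    ∎
  where open ≡-Reasoning

sumQ-scale : ∀ {A : Set} (c : ℚ) (f : A → ℚ) (xs : List A) →
             sumQ (map (λ x → c * f x) xs) ≡ c * sumQ (map f xs)
sumQ-scale c f []       = sym (*-zeroʳ c)
sumQ-scale c f (x ∷ xs) = trans (cong (c * f x +_) (sumQ-scale c f xs)) (sym (*-distribˡ-+ c _ _))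

sumQ-cong : ∀ {A : Set} {f g : A → ℚ} (xs : List A) → (∀ x → f x ≡ g x) → sumQ (map f xs) ≡ sumQ (map g xs)
sumQ-cong []       f≗g = refl
sumQ-cong (x ∷ xs) f≗g = cong₂ _+_ (f≗g x) (sumQ-cong xs f≗g)

eH-xor : ∀ a b → eH (a xor b) ≡ eH a * eH b
eH-xor false false = refl
eH-xor false true  = refl
eH-xor true  false = refl
eH-xor true  true  = refl

eH-square : ∀ a → eH a * eH a ≡ 1ℚ
eH-square false = refl
eH-square true  = refl

eH-not : ∀ a → eH (not a) ≡ - eH a
eH-not false = refl
eH-not true  = refl

eH-signOver8 : ∀ {k} (ss : Vec Bool k) → eH (signOver8 ss) ≡ ε ss
eH-signOver8 []           = refl
eH-signOver8 (true ∷ ss)  = eH-signOver8 ss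
eH-signOver8 (false ∷ ss) = trans (eH-not (signOver8 ss)) (cong -_ (eH-signOver8 ss))

ε-square : ∀ {k} (ss : Vec Bool k) → ε ss * ε ss ≡ 1ℚ
ε-square ss = trans (sym (cong₂ _*_ (eH-signOver8 ss) (eH-signOver8 ss))) (eH-square (signOver8 ss))

ε-∷ : ∀ {k} s (ss : Vec Bool k) → ε (s ∷ ss) ≡ ε (s ∷ []) * ε ss
ε-∷ true  ss = sym (*-identityˡ (ε ss))
ε-∷ false ss = negate (ε ss)
  where
  negate : ∀ x → - x ≡ - 1ℚ * x
  negate = solve-∀ ℚ-ring

bil-sym : ∀ {k} (a b : Elt k) → bil a b ≡ bil b a
bil-sym [] [] = refl
bil-sym ((x , y) ∷ as) ((x′ , y′) ∷ bs) = cong₂ _xor_ plane (bil-sym as bs)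
  where
  plane : (x ∧ y′) xor (y ∧ x′) ≡ (x′ ∧ y) xor (y′ ∧ x)
  plane = trans (Boolₚ.xor-comm (x ∧ y′) _) (cong₂ _xor_ (Boolₚ.∧-comm y x′) (Boolₚ.∧-comm x y′))

∧-true : ∀ {a b} → a ∧ b ≡ true → a ≡ true × b ≡ true
∧-true {true} b≡true = refl , b≡true

eqB-sound : ∀ {x y} → eqB x y ≡ true → x ≡ y
eqB-sound {true}  {true}  _ = refl
eqB-sound {false} {false} _ = refl

eqElt-sound : ∀ {k} (γ μ : Elt k) → eqElt γ μ ≡ true → γ ≡ μ
eqElt-sound []            []              _  = refl
eqElt-sound ((x , y) ∷ γ) ((x′ , y′) ∷ μ) eq =
  let (x≡ , rest) = ∧-true eq ; (y≡ , γ≡) = ∧-true rest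
  in cong₂ _∷_ (cong₂ _,_ (eqB-sound x≡) (eqB-sound y≡)) (eqElt-sound γ μ γ≡)

eVec-∷ : ∀ {k} (a c : Bool × Bool) (γ μ : Elt k) → eVec (a ∷ γ) (c ∷ μ) ≡ eVec (a ∷ []) (c ∷ []) * eVec γ μ
eVec-∷ (x , y) (x′ , y′) γ μ with eqB x x′ | eqB y y′
... | true  | true  = sym (*-identityˡ (eVec γ μ))
... | true  | false = sym (*-zeroˡ (eVec γ μ))
... | false | _     = sym (*-zeroˡ (eVec γ μ))

-- Sums over D, one hyperbolic plane at a time

planePoints : List (Bool × Bool)
planePoints = (false , false) ∷ (false , true) ∷ (true , false) ∷ (true , true) ∷ []

ΣPlane : (Bool × Bool → ℚ) → ℚ
ΣPlane P = sumQ (map P planePoints)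

ΣD-cong : ∀ k {f g : Elt k → ℚ} → (∀ x → f x ≡ g x) → ΣD k f ≡ ΣD k g
ΣD-cong k = sumQ-cong (allElt k)

ΣD-scale : ∀ k c (f : Elt k → ℚ) → ΣD k (λ x → c * f x) ≡ c * ΣD k f
ΣD-scale k c f = sumQ-scale c f (allElt k)

ΣD-suc : ∀ k (f : Elt (suc k) → ℚ) → ΣD (suc k) f ≡ ΣPlane (λ b → ΣD k (λ β → f (b ∷ β)))
ΣD-suc k f = trans (sumQ-concatMap f (λ b → map (b ∷_) (allElt k)) planePoints)
                   (sumQ-cong planePoints (λ b → cong sumQ (sym (map-∘ {g = f} {f = b ∷_} (allElt k)))))

ΣD-suc-product : ∀ k (f : Elt (suc k) → ℚ) (P : Bool × Bool → ℚ) (Q : Elt k → ℚ) →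
                 (∀ b β → f (b ∷ β) ≡ P b * Q β) → ΣD (suc k) f ≡ ΣPlane P * ΣD k Q
ΣD-suc-product k f P Q f≡PQ = begin
  ΣD (suc k) f                           ≡⟨ ΣD-suc k f ⟩
  ΣPlane (λ b → ΣD k (λ β → f (b ∷ β))) ≡⟨ sumQ-cong planePoints row ⟩
  ΣPlane (λ b → P b * ΣD k Q)           ≡⟨ distrib (P _) (P _) (P _) (P _) (ΣD k Q) ⟩
  ΣPlane P * ΣD k Q                      ∎
  where
  open ≡-Reasoning
  row : ∀ b → ΣD k (λ β → f (b ∷ β)) ≡ P b * ΣD k Q
  row b = trans (ΣD-cong k {g = λ β → P b * Q β} (f≡PQ b)) (ΣD-scale k (P b) Q)
  distrib : ∀ a b c d S → a * S + (b * S + (c * S + (d * S + 0ℚ))) ≡ (a + (b + (c + (d + 0ℚ)))) * S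
  distrib = solve-∀ ℚ-ring

ΣPlane-eVec : ∀ a (h : Bool × Bool → ℚ) → ΣPlane (λ b → eVec (a ∷ []) (b ∷ []) * h b) ≡ h a
ΣPlane-eVec (false , false) h = pick₁ (h _) (h _) (h _) (h _)
  where
  pick₁ : ∀ A B C D → 1ℚ * A + (0ℚ * B + (0ℚ * C + (0ℚ * D + 0ℚ))) ≡ A
  pick₁ = solve-∀ ℚ-ring
ΣPlane-eVec (false , true) h = pick₂ (h _) (h _) (h _) (h _)
  where
  pick₂ : ∀ A B C D → 0ℚ * A + (1ℚ * B + (0ℚ * C + (0ℚ * D + 0ℚ))) ≡ B
  pick₂ = solve-∀ ℚ-ring
ΣPlane-eVec (true , false) h = pick₃ (h _) (h _) (h _) (h _)
  where
  pick₃ : ∀ A B C D → 0ℚ * A + (0ℚ * B + (1ℚ * C + (0ℚ * D + 0ℚ))) ≡ C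
  pick₃ = solve-∀ ℚ-ring
ΣPlane-eVec (true , true) h = pick₄ (h _) (h _) (h _) (h _)
  where
  pick₄ : ∀ A B C D → 0ℚ * A + (0ℚ * B + (0ℚ * C + (1ℚ * D + 0ℚ))) ≡ D
  pick₄ = solve-∀ ℚ-ring

ΣD-eVec : ∀ k (γ : Elt k) (g : Elt k → ℚ) → ΣD k (λ β → eVec γ β * g β) ≡ g γ
ΣD-eVec zero    []      g = trans (+-identityʳ _) (*-identityˡ _)
ΣD-eVec (suc k) (a ∷ γ) g = begin
  ΣD (suc k) (λ β → eVec (a ∷ γ) β * g β)                         ≡⟨ ΣD-suc k _ ⟩
  ΣPlane (λ b → ΣD k (λ β → eVec (a ∷ γ) (b ∷ β) * g (b ∷ β)))   ≡⟨ sumQ-cong planePoints row ⟩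
  ΣPlane (λ b → eVec (a ∷ []) (b ∷ []) * g (b ∷ γ))               ≡⟨ ΣPlane-eVec a (λ b → g (b ∷ γ)) ⟩
  g (a ∷ γ)                                                        ∎
  where
  open ≡-Reasoning
  row : ∀ b → ΣD k (λ β → eVec (a ∷ γ) (b ∷ β) * g (b ∷ β)) ≡ eVec (a ∷ []) (b ∷ []) * g (b ∷ γ)
  row b = begin
    ΣD k (λ β → eVec (a ∷ γ) (b ∷ β) * g (b ∷ β))
      ≡⟨ ΣD-cong k (λ β → trans (cong (_* g (b ∷ β)) (eVec-∷ a b γ β)) (*-assoc e (eVec γ β) (g (b ∷ β)))) ⟩
    ΣD k (λ β → e * (eVec γ β * g (b ∷ β)))
      ≡⟨ ΣD-scale k e (λ β → eVec γ β * g (b ∷ β)) ⟩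
    e * ΣD k (λ β → eVec γ β * g (b ∷ β))
      ≡⟨ cong (e *_) (ΣD-eVec k γ (λ β → g (b ∷ β))) ⟩
    e * g (b ∷ γ) ∎
    where
    e = eVec (a ∷ []) (b ∷ [])

plane-orthogonality : ∀ a c → (½ * ½) * ΣPlane (λ b → eH (bPlane a b) * eH (bPlane b c)) ≡ eVec (a ∷ []) (c ∷ [])
plane-orthogonality (false , false) (false , false) = refl
plane-orthogonality (false , false) (false , true) = refl
plane-orthogonality (false , false) (true , false) = refl
plane-orthogonality (false , false) (true , true) = refl
plane-orthogonality (false , true) (false , false) = refl
plane-orthogonality (false , true) (false , true) = refl
plane-orthogonality (false , true) (true , false) = refl
plane-orthogonality (false , true) (true , true) = refl
plane-orthogonality (true , false) (false , false) = refl
plane-orthogonality (true , false) (false , true) = refl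
plane-orthogonality (true , false) (true , false) = refl
plane-orthogonality (true , false) (true , true) = refl
plane-orthogonality (true , true) (false , false) = refl
plane-orthogonality (true , true) (false , true) = refl
plane-orthogonality (true , true) (true , false) = refl
plane-orthogonality (true , true) (true , true) = refl

plane-gauss : ∀ s a c → ½ * ΣPlane (λ b → (eH (qPlane s b) * eH (bPlane a b)) * eH (bPlane b c))
                        ≡ ε (s ∷ []) * (eH (qPlane s a) * (eH (qPlane s c) * eH (bPlane a c)))
plane-gauss false (false , false) (false , false) = refl
plane-gauss false (false , false) (false , true) = refl
plane-gauss false (false , false) (true , false) = refl
plane-gauss false (false , false) (true , true) = refl
plane-gauss false (false , true) (false , false) = refl
plane-gauss false (false , true) (false , true) = refl
plane-gauss false (false , true) (true , false) = refl
plane-gauss false (false , true) (true , true) = refl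
plane-gauss false (true , false) (false , false) = refl
plane-gauss false (true , false) (false , true) = refl
plane-gauss false (true , false) (true , false) = refl
plane-gauss false (true , false) (true , true) = refl
plane-gauss false (true , true) (false , false) = refl
plane-gauss false (true , true) (false , true) = refl
plane-gauss false (true , true) (true , false) = refl
plane-gauss false (true , true) (true , true) = refl
plane-gauss true (false , false) (false , false) = refl
plane-gauss true (false , false) (false , true) = refl
plane-gauss true (false , false) (true , false) = refl
plane-gauss true (false , false) (true , true) = refl
plane-gauss true (false , true) (false , false) = refl
plane-gauss true (false , true) (false , true) = refl
plane-gauss true (false , true) (true , false) = refl
plane-gauss true (false , true) (true , true) = refl
plane-gauss true (true , false) (false , false) = refl
plane-gauss true (true , false) (false , true) = refl
plane-gauss true (true , false) (true , false) = refl
plane-gauss true (true , false) (true , true) = refl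
plane-gauss true (true , true) (false , false) = refl
plane-gauss true (true , true) (false , true) = refl
plane-gauss true (true , true) (true , false) = refl
plane-gauss true (true , true) (true , true) = refl

character-orthogonality : ∀ k (γ μ : Elt k) →
  (invSqrtCard k * invSqrtCard k) * ΣD k (λ β → eH (bil γ β) * eH (bil β μ)) ≡ eVec γ μ
character-orthogonality zero    []      []      = refl
character-orthogonality (suc k) (a ∷ γ) (c ∷ μ) = begin
  (½ * h * (½ * h)) * ΣD (suc k) _           ≡⟨ cong ((½ * h * (½ * h)) *_) (ΣD-suc-product k _ P Q split) ⟩
  (½ * h * (½ * h)) * (ΣPlane P * ΣD k Q)    ≡⟨ regroup ½ h (ΣPlane P) (ΣD k Q) ⟩
  ((½ * ½) * ΣPlane P) * ((h * h) * ΣD k Q)  ≡⟨ cong₂ _*_ (plane-orthogonality a c) (character-orthogonality k γ μ) ⟩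
  eVec (a ∷ []) (c ∷ []) * eVec γ μ          ≡⟨ eVec-∷ a c γ μ ⟨
  eVec (a ∷ γ) (c ∷ μ)                       ∎
  where
  open ≡-Reasoning
  h = invSqrtCard k
  P : Bool × Bool → ℚ
  P b = eH (bPlane a b) * eH (bPlane b c)
  Q : Elt k → ℚ
  Q β = eH (bil γ β) * eH (bil β μ)
  regroup : ∀ x y S T → (x * y * (x * y)) * (S * T) ≡ ((x * x) * S) * ((y * y) * T)
  regroup = solve-∀ ℚ-ring
  interchange : ∀ x y z w → (x * y) * (z * w) ≡ (x * z) * (y * w)
  interchange = solve-∀ ℚ-ring
  split : ∀ b β → eH (bPlane a b xor bil γ β) * eH (bPlane b c xor bil β μ) ≡ P b * Q β
  split b β = trans (cong₂ _*_ (eH-xor (bPlane a b) (bil γ β)) (eH-xor (bPlane b c) (bil β μ)))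
                    (interchange (eH (bPlane a b)) (eH (bil γ β)) (eH (bPlane b c)) (eH (bil β μ)))

gauss-sum : ∀ k (ss : Vec Bool k) (γ μ : Elt k) →
  invSqrtCard k * ΣD k (λ β → (eH (q ss β) * eH (bil γ β)) * eH (bil β μ))
  ≡ ε ss * (eH (q ss γ) * (eH (q ss μ) * eH (bil γ μ)))
gauss-sum zero    []       []      []      = refl
gauss-sum (suc k) (s ∷ ss) (a ∷ γ) (c ∷ μ) = begin
  (½ * h) * ΣD (suc k) _                      ≡⟨ cong ((½ * h) *_) (ΣD-suc-product k _ P Q split) ⟩
  (½ * h) * (ΣPlane P * ΣD k Q)               ≡⟨ regroup ½ h (ΣPlane P) (ΣD k Q) ⟩
  (½ * ΣPlane P) * (h * ΣD k Q)               ≡⟨ cong₂ _*_ (plane-gauss s a c) (gauss-sum k ss γ μ) ⟩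
  (ε (s ∷ []) * (eH qa * (eH qc * eH bac))) * (ε ss * (eH (q ss γ) * (eH (q ss μ) * eH (bil γ μ))))
    ≡⟨ interleave (ε (s ∷ [])) (ε ss) (eH qa) (eH (q ss γ)) (eH qc) (eH (q ss μ)) (eH bac) (eH (bil γ μ)) ⟩
  (ε (s ∷ []) * ε ss) * ((eH qa * eH (q ss γ)) * ((eH qc * eH (q ss μ)) * (eH bac * eH (bil γ μ))))
    ≡⟨ cong₂ _*_ (ε-∷ s ss) (cong₂ _*_ (eH-xor qa (q ss γ)) (cong₂ _*_ (eH-xor qc (q ss μ)) (eH-xor bac (bil γ μ)))) ⟨
  ε (s ∷ ss) * (eH (q (s ∷ ss) (a ∷ γ)) * (eH (q (s ∷ ss) (c ∷ μ)) * eH (bil (a ∷ γ) (c ∷ μ)))) ∎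
  where
  open ≡-Reasoning
  h = invSqrtCard k
  qa = qPlane s a
  qc = qPlane s c
  bac = bPlane a c
  P : Bool × Bool → ℚ
  P b = (eH (qPlane s b) * eH (bPlane a b)) * eH (bPlane b c)
  Q : Elt k → ℚ
  Q β = (eH (q ss β) * eH (bil γ β)) * eH (bil β μ)
  regroup : ∀ x y S T → (x * y) * (S * T) ≡ (x * S) * (y * T)
  regroup = solve-∀ ℚ-ring
  interleave : ∀ s₁ s₂ a₁ a₂ b₁ b₂ c₁ c₂ →
    (s₁ * (a₁ * (b₁ * c₁))) * (s₂ * (a₂ * (b₂ * c₂))) ≡ (s₁ * s₂) * ((a₁ * a₂) * ((b₁ * b₂) * (c₁ * c₂)))
  interleave = solve-∀ ℚ-ring
  interchange₃ : ∀ x₁ x₂ y₁ y₂ z₁ z₂ → ((x₁ * x₂) * (y₁ * y₂)) * (z₁ * z₂) ≡ ((x₁ * y₁) * z₁) * ((x₂ * y₂) * z₂)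
  interchange₃ = solve-∀ ℚ-ring
  split : ∀ b β → (eH (qPlane s b xor q ss β) * eH (bPlane a b xor bil γ β)) * eH (bPlane b c xor bil β μ) ≡ P b * Q β
  split b β = trans (cong₂ _*_ (cong₂ _*_ (eH-xor (qPlane s b) (q ss β)) (eH-xor (bPlane a b) (bil γ β)))
                                (eH-xor (bPlane b c) (bil β μ)))
                    (interchange₃ (eH (qPlane s b)) (eH (q ss β)) (eH (bPlane a b)) (eH (bil γ β))
                                  (eH (bPlane b c)) (eH (bil β μ)))

-- SL₂(𝔽₂)

sl2 : Fin 6 → Mat2
sl2 0F = (true  , false , false , true)
sl2 1F = (true  , true  , false , true)
sl2 2F = (false , true  , true  , false)
sl2 3F = (false , true  , true  , true)
sl2 4F = (true  , true  , true  , false)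
sl2 5F = (true  , false , true  , true)

sl2-index : Mat2 → Fin 6
sl2-index (true  , false , false , true)  = 0F
sl2-index (true  , true  , false , true)  = 1F
sl2-index (false , true  , true  , false) = 2F
sl2-index (false , true  , true  , true)  = 3F
sl2-index (true  , true  , true  , false) = 4F
sl2-index (true  , false , true  , true)  = 5F
sl2-index _                               = 0F

sl2-closed : ∀ g j → sl2 (sl2-index (mul2 (genMod2 g) (sl2 j))) ≡ mul2 (genMod2 g) (sl2 j)
sl2-closed S 0F = refl
sl2-closed S 1F = refl
sl2-closed S 2F = refl
sl2-closed S 3F = refl
sl2-closed S 4F = refl
sl2-closed S 5F = refl
sl2-closed T 0F = refl
sl2-closed T 1F = refl
sl2-closed T 2F = refl
sl2-closed T 3F = refl
sl2-closed T 4F = refl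
sl2-closed T 5F = refl

wordIndex : Word → Fin 6
wordIndex []      = 0F
wordIndex (g ∷ w) = sl2-index (mul2 (genMod2 g) (sl2 (wordIndex w)))

sl2-wordIndex : ∀ w → sl2 (wordIndex w) ≡ wordMod2 w
sl2-wordIndex []      = refl
sl2-wordIndex (g ∷ w) = trans (sl2-closed g (wordIndex w)) (cong (mul2 (genMod2 g)) (sl2-wordIndex w))

-- The orbit of an isotropic e^γ

module IsotropicOrbit {k} (ss : Vec Bool k) (γ : Elt k) (γ-isotropic : q ss γ ≡ false) where

  h : ℚ
  h = invSqrtCard k

  c : ℚ
  c = ε ss * h

  -- ρ(M) e^γ as a function of the first column (a, c′) of M mod 2; the zero column is unreachable.
  orbit : Bool → Bool → CD k
  orbit true  false   = eVec γ
  orbit false true  μ = c * eH (bil γ μ)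
  orbit true  true  μ = eH (q ss μ) * (c * eH (bil γ μ))
  orbit false false _ = 0ℚ

  orbitAt : Mat2 → CD k
  orbitAt (a , _ , c′ , _) = orbit a c′

  ρGen-cong : ∀ g {v v′ : CD k} → (∀ β → v β ≡ v′ β) → ∀ μ → ρGen ss g v μ ≡ ρGen ss g v′ μ
  ρGen-cong T v≗v′ μ = cong (eH (q ss μ) *_) (v≗v′ μ)
  ρGen-cong S v≗v′ μ = cong (eH (signOver8 ss) * h *_) (ΣD-cong k (λ β → cong (_* eH (bil β μ)) (v≗v′ β)))

  ρS : ∀ (v : CD k) μ → ρGen ss S v μ ≡ c * ΣD k (λ β → v β * eH (bil β μ))
  ρS v μ = cong (λ e → (e * h) * ΣD k (λ β → v β * eH (bil β μ))) (eH-signOver8 ss)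

  ρS-scaled : ∀ (f : CD k) μ → ρGen ss S (λ β → c * f β) μ ≡ h * (h * ΣD k (λ β → f β * eH (bil β μ)))
  ρS-scaled f μ = begin
    ρGen ss S (λ β → c * f β) μ                   ≡⟨ ρS (λ β → c * f β) μ ⟩
    c * ΣD k (λ β → (c * f β) * eH (bil β μ))    ≡⟨ cong (c *_) (ΣD-cong k (λ β → *-assoc c (f β) (eH (bil β μ)))) ⟩
    c * ΣD k (λ β → c * (f β * eH (bil β μ)))    ≡⟨ cong (c *_) (ΣD-scale k c (λ β → f β * eH (bil β μ))) ⟩
    c * (c * Σ)                                   ≡⟨ regroup (ε ss) h Σ ⟩
    (ε ss * ε ss) * (h * (h * Σ))                 ≡⟨ cong (_* (h * (h * Σ))) (ε-square ss) ⟩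
    1ℚ * (h * (h * Σ))                            ≡⟨ *-identityˡ _ ⟩
    h * (h * Σ)                                   ∎
    where
    open ≡-Reasoning
    Σ = ΣD k (λ β → f β * eH (bil β μ))
    regroup : ∀ e x y → (e * x) * ((e * x) * y) ≡ (e * e) * (x * (x * y))
    regroup = solve-∀ ℚ-ring

  ρT-eVec : ∀ μ → ρGen ss T (eVec γ) μ ≡ eVec γ μ
  ρT-eVec μ with eqElt γ μ in γ≟μ
  ... | true  = trans (cong (λ x → eH (q ss x) * 1ℚ) (sym (eqElt-sound γ μ γ≟μ)))
                      (cong (λ b → eH b * 1ℚ) γ-isotropic)
  ... | false = *-zeroʳ (eH (q ss μ))

  ρT-orbit : ∀ a c′ μ → ρGen ss T (orbit a c′) μ ≡ orbit (a xor c′) c′ μ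
  ρT-orbit true  false μ = ρT-eVec μ
  ρT-orbit false true  μ = refl
  ρT-orbit true  true  μ = begin
    eH (q ss μ) * (eH (q ss μ) * (c * eH (bil γ μ))) ≡⟨ *-assoc (eH (q ss μ)) _ _ ⟨
    (eH (q ss μ) * eH (q ss μ)) * (c * eH (bil γ μ)) ≡⟨ cong (_* (c * eH (bil γ μ))) (eH-square (q ss μ)) ⟩
    1ℚ * (c * eH (bil γ μ))                          ≡⟨ *-identityˡ _ ⟩
    c * eH (bil γ μ)                                 ∎
    where open ≡-Reasoning
  ρT-orbit false false μ = *-zeroʳ (eH (q ss μ))

  ρS-orbit : ∀ a c′ μ → ρGen ss S (orbit a c′) μ ≡ orbit c′ a μ
  ρS-orbit true false μ = trans (ρS (eVec γ) μ) (cong (c *_) (ΣD-eVec k γ (λ β → eH (bil β μ))))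
  ρS-orbit false true μ = begin
    ρGen ss S (λ β → c * eH (bil γ β)) μ                          ≡⟨ ρS-scaled (λ β → eH (bil γ β)) μ ⟩
    h * (h * ΣD k (λ β → eH (bil γ β) * eH (bil β μ)))            ≡⟨ *-assoc h h _ ⟨
    (h * h) * ΣD k (λ β → eH (bil γ β) * eH (bil β μ))            ≡⟨ character-orthogonality k γ μ ⟩
    eVec γ μ                                                      ∎
    where open ≡-Reasoning
  ρS-orbit true true μ = begin
    ρGen ss S (orbit true true) μ                                 ≡⟨ ρGen-cong S (λ β → pull (eH (q ss β)) c (eH (bil γ β))) μ ⟩
    ρGen ss S (λ β → c * (eH (q ss β) * eH (bil γ β))) μ          ≡⟨ ρS-scaled (λ β → eH (q ss β) * eH (bil γ β)) μ ⟩
    h * (h * ΣD k (λ β → (eH (q ss β) * eH (bil γ β)) * eH (bil β μ)))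
                                                                  ≡⟨ cong (h *_) (gauss-sum k ss γ μ) ⟩
    h * (ε ss * (eH (q ss γ) * (eH (q ss μ) * eH (bil γ μ))))     ≡⟨ cong (λ b → h * (ε ss * (eH b * (eH (q ss μ) * eH (bil γ μ))))) γ-isotropic ⟩
    h * (ε ss * (1ℚ * (eH (q ss μ) * eH (bil γ μ))))              ≡⟨ finish (ε ss) h (eH (q ss μ)) (eH (bil γ μ)) ⟩
    eH (q ss μ) * (c * eH (bil γ μ))                              ∎
    where
    open ≡-Reasoning
    pull : ∀ x y z → x * (y * z) ≡ y * (x * z)
    pull = solve-∀ ℚ-ring
    finish : ∀ e x y z → x * (e * (1ℚ * (y * z))) ≡ y * ((e * x) * z)
    finish = solve-∀ ℚ-ring
  ρS-orbit false false μ = trans (ρS (λ _ → 0ℚ) μ) (trans (cong (c *_) zeros) (*-zeroʳ c))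
    where
    zeros : ΣD k (λ β → 0ℚ * eH (bil β μ)) ≡ 0ℚ
    zeros = trans (ΣD-scale k 0ℚ (λ β → eH (bil β μ))) (*-zeroˡ (ΣD k (λ β → eH (bil β μ))))

  ρGen-orbitAt : ∀ g m μ → ρGen ss g (orbitAt m) μ ≡ orbitAt (mul2 (genMod2 g) m) μ
  ρGen-orbitAt T (a , _ , c′ , _) μ = ρT-orbit a c′ μ
  ρGen-orbitAt S (a , _ , c′ , _) μ = trans (ρS-orbit a c′ μ) (cong (λ a′ → orbit c′ a′ μ) (sym (Boolₚ.xor-identityʳ a)))

  ρWord-eVec : ∀ w μ → ρWord ss w (eVec γ) μ ≡ orbitAt (wordMod2 w) μ
  ρWord-eVec []      μ = refl
  ρWord-eVec (g ∷ w) μ = trans (ρGen-cong g (ρWord-eVec w) μ) (ρGen-orbitAt g (wordMod2 w) μ)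

  orbit-average : ∀ μ → ((ℤ.+ 1) / 6) * sum (λ j → orbitAt (sl2 j) μ) ≡ rhs ss γ μ
  orbit-average μ = begin
    ((ℤ.+ 1) / 6) * (δ + (δ + (F + (F + (eH Q * F + (eH Q * F + 0ℚ))))))
      ≡⟨ average (ε ss) h δ (eH (bil γ μ)) (eH Q) ⟩
    coeff * (½ * (eH (bil γ μ) * (1ℚ + eH Q))) + ((ℤ.+ 1) / 3) * δ
      ≡⟨ cong (λ b → coeff * (½ * (eH b * (1ℚ + eH Q))) + ((ℤ.+ 1) / 3) * δ) (bil-sym γ μ) ⟩
    coeff * (½ * (eH (bil μ γ) * (1ℚ + eH Q))) + ((ℤ.+ 1) / 3) * δ
      ≡⟨ cong (λ x → coeff * x + ((ℤ.+ 1) / 3) * δ) (isotropic-indicator Q (bil μ γ)) ⟨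
    rhs ss γ μ ∎
    where
    open ≡-Reasoning
    δ = eVec γ μ
    Q = q ss μ
    F = c * eH (bil γ μ)
    coeff = (ε ss * ((ℤ.+ 1) / 3)) * ((ℤ.+ 2) / 1 * h)
    average : ∀ e x d b t →
      ((ℤ.+ 1) / 6) * (d + (d + ((e * x) * b + ((e * x) * b + (t * ((e * x) * b) + (t * ((e * x) * b) + 0ℚ))))))
      ≡ ((e * ((ℤ.+ 1) / 3)) * ((ℤ.+ 2) / 1 * x)) * (½ * (b * (1ℚ + t))) + ((ℤ.+ 1) / 3) * d
    average = solve-∀ ℚ-ring
    isotropic-indicator : ∀ Q B →
      (if not Q ∧ not B then (ℤ.+ 2) / 1 else 0ℚ) + - (if not Q then 1ℚ else 0ℚ) ≡ ½ * (eH B * (1ℚ + eH Q))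
    isotropic-indicator false false = refl
    isotropic-indicator false true  = refl
    isotropic-indicator true  false = refl
    isotropic-indicator true  true  = refl

theorem4p2 : (k : ℕ) (ss : Vec Bool k)
             (reps : Vec Word 6)
             → (∀ i j → wordMod2 (lookup reps i) ≡ wordMod2 (lookup reps j) → i ≡ j)
             → (γ : Elt k) → isIsotropic ss γ ≡ true
             → (μ : Elt k) → invD ss reps (eVec γ) μ ≡ rhs ss γ μ
theorem4p2 k ss reps reps-distinct γ γ-isotropic μ = begin
  ⅙ * sumQ (map (λ w → ρWord ss w (eVec γ) μ) (toList reps))  ≡⟨ cong (⅙ *_) (sumQ-toList _ reps) ⟩
  ⅙ * sum (λ i → ρWord ss (lookup reps i) (eVec γ) μ)         ≡⟨ cong (⅙ *_) (sum-cong-≗ orbit-of-rep) ⟩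
  ⅙ * sum (λ i → orbitAt (sl2 (index i)) μ)                   ≡⟨ cong (⅙ *_) (sum-reindex (λ j → orbitAt (sl2 j) μ) index index-injective) ⟩
  ⅙ * sum (λ j → orbitAt (sl2 j) μ)                           ≡⟨ orbit-average μ ⟩
  rhs ss γ μ                                                  ∎
  where
  open ≡-Reasoning
  open IsotropicOrbit ss γ (trans (sym (Boolₚ.not-involutive (q ss γ))) (cong not γ-isotropic))
  ⅙ = (ℤ.+ 1) / 6
  index : Fin 6 → Fin 6
  index i = wordIndex (lookup reps i)
  index-injective : Injective _≡_ _≡_ index
  index-injective {i} {j} eq =
    reps-distinct i j (trans (sym (sl2-wordIndex (lookup reps i))) (trans (cong sl2 eq) (sl2-wordIndex (lookup reps j))))
  orbit-of-rep : ∀ i → ρWord ss (lookup reps i) (eVec γ) μ ≡ orbitAt (sl2 (index i)) μ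
  orbit-of-rep i = trans (ρWord-eVec (lookup reps i) μ) (cong (λ m → orbitAt m μ) (sym (sl2-wordIndex (lookup reps i))))
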